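{- If $n \geq 2$ is even, then \[ f(n,3) \leq 2^{n/2} + \sum_{i=1}^{\lceil n/4 \rceil} \binom{n/2}{2i-1} 2^{(n/2) - 2i + 1}. \]
   Context: For integers $n \geq 1$ and $q \geq 2$, let $\mathbb Z_q = \mathbb Z/q\mathbb Z$ and consider $\mathbb Z_q^n$ with the Hamming distance $d(x,y)$ = number of coordinates in which $x$ and $y$ differ. Say $x$ skirts $y$ if $d(x,y) = n$. A set $S \subseteq \mathbb Z_q^n$ is a skirting set if every $y \in \mathbb Z_q^n$ is skirted by some $x \in S$. Let $f(n,q)$ denote the minimum size of a skirting set in $\mathbb Z_q^n$. Binomial coefficients $\binom{a}{b}$ with $b > a$ are $0$. -}

module Defs where

open import Data.Nat using (ℕ; zero; suc; _+_; _*_; _∸_; _^_; _≤_)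
open import Data.Nat.Combinatorics using (_C_)
open import Data.Fin using (Fin)
open import Data.List using (List; length)
open import Data.List.Membership.Propositional using (_∈_)
open import Data.Product using (Σ; _×_; ∃-syntax)
open import Relation.Binary.PropositionalEquality using (_≢_)

Word : ℕ → ℕ → Set
Word n q = Fin n → Fin q

Skirts : ∀ {n q} → Word n q → Word n q → Set
Skirts x y = ∀ i → x i ≢ y i

IsSkirting : ∀ {n q} → List (Word n q) → Set
IsSkirting {n} {q} S = ∀ (y : Word n q) → ∃[ x ] (x ∈ S × Skirts x y)

-- f(n,q) ≤ B : some skirting set has at most B elements
-- (a list of length ≤ B has at most B distinct elements; conversely a set
-- of size ≤ B can be listed without repetition).
fLe : ℕ → ℕ → ℕ → Set
fLe n q B = ∃[ S ] (IsSkirting {n} {q} S × length S ≤ B)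

sumFrom1 : ℕ → (ℕ → ℕ) → ℕ
sumFrom1 zero    g = 0
sumFrom1 (suc k) g = sumFrom1 k g + g (suc k)

ceilHalf : ℕ → ℕ
ceilHalf zero = 0
ceilHalf (suc zero) = 1
ceilHalf (suc (suc a)) = suc (ceilHalf a)

-- The bound for n = 2m:  2^m + Σ_{i=1}^{⌈m/2⌉} C(m,2i-1) 2^(m-2i+1)
-- (⌈n/4⌉ = ⌈m/2⌉; 2i-1 ≤ m for such i, so the exponent m-(2i-1) is exact).
bound : ℕ → ℕ
bound m = 2 ^ m + sumFrom1 (ceilHalf m) (λ i → (m C (2 * i ∸ 1)) * 2 ^ (m ∸ (2 * i ∸ 1)))

-- Cut the 2m coordinates into m pairs, so that a word is a sequence of m blocks in ℤ₃².
-- The 2^m words whose blocks are all (0,0) or (1,1) skirt every y having no block (0,1) or (1,0).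
-- Every block of y is skirted by (2,2) or by one of (0,1), (1,0), so y is skirted by a word whose
-- blocks lie in {(2,2),(0,1),(1,0)}; if y has a block (0,1) or (1,0), both (2,2) and one of
-- (0,1), (1,0) skirt it, so the number j of (2,2) blocks can be made odd, j = 2i − 1 ≤ m.
-- There are C(m,j)·2^(m−j) such words for each j.

module Submission where

open import Defs
open import Data.Nat using (ℕ; zero; suc; _+_; _*_; _∸_; _^_; _≤_; _<?_; z≤n; s≤s)
open import Data.Nat.Properties
open import Data.Nat.Combinatorics using (_C_; nCk+nC[k+1]≡[n+1]C[k+1]; k>n⇒nCk≡0)
open import Algebra.Properties.CommutativeSemigroup *-commutativeSemigroup using (x∙yz≈y∙xz)
open import Data.Fin using (Fin; zero; suc; remQuot; combine)
open import Data.Fin.Properties using (combine-remQuot)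
open import Data.Fin.Patterns using (0F; 1F; 2F)
open import Data.Product using (_×_; _,_; proj₁; proj₂; ∃-syntax)
open import Data.Sum using (_⊎_; inj₁; inj₂)
import Data.List as List
open import Data.List using (List; [_]; _++_; map; length; cartesianProductWith)
open import Data.List.Properties using (length-map; length-++)
open import Data.List.Membership.Propositional using (_∈_)
open import Data.List.Membership.Propositional.Properties
  using (∈-map⁺; ∈-++⁺ˡ; ∈-++⁺ʳ; ∈-cartesianProductWith⁺)
open import Data.List.Relation.Unary.Any using (here; there)
open import Data.Vec.Functional using (Vector; []; _∷_; head; tail)
open import Data.Vec.Functional.Relation.Binary.Pointwise using (Pointwise)
open import Function using (_∘_)
open import Relation.Binary.PropositionalEquality
  using (_≡_; _≢_; refl; sym; trans; cong; cong₂; module ≡-Reasoning)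
open import Relation.Nullary using (yes; no)

module _ {A B : Set} (R : A → B → Set) where

  Covered : List A → B → Set
  Covered S b = ∃[ x ] x ∈ S × R x b

  Pointwise-∷ : ∀ {m a} {x : Vector A m} {y : Vector B (suc m)} →
                R a (head y) → Pointwise R x (tail y) → Pointwise R (a ∷ x) y
  Pointwise-∷ r rs zero    = r
  Pointwise-∷ r rs (suc k) = rs k

module _ {A : Set} where

  infixr 5 _⊗_

  _⊗_ : ∀ {m} → List A → List (Vector A m) → List (Vector A (suc m))
  cs ⊗ xs = cartesianProductWith _∷_ cs xs

  length-⊗ : ∀ {m} (cs : List A) (xs : List (Vector A m)) →
             length (cs ⊗ xs) ≡ length cs * length xs
  length-⊗ List.[]        xs = refl
  length-⊗ (c List.∷ cs) xs = begin
    length (map (c ∷_) xs ++ cs ⊗ xs)         ≡⟨ length-++ (map (c ∷_) xs) ⟩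
    length (map (c ∷_) xs) + length (cs ⊗ xs) ≡⟨ cong₂ _+_ (length-map (c ∷_) xs) (length-⊗ cs xs) ⟩
    length xs + length cs * length xs         ∎
    where open ≡-Reasoning

  ∈-⊗ : ∀ {m c cs x} {xs : List (Vector A m)} → c ∈ cs → x ∈ xs → c ∷ x ∈ cs ⊗ xs
  ∈-⊗ = ∈-cartesianProductWith⁺ _∷_

  words : List A → (m : ℕ) → List (Vector A m)
  words cs zero    = [ [] ]
  words cs (suc m) = cs ⊗ words cs m

  length-words : ∀ cs m → length (words cs m) ≡ length cs ^ m
  length-words cs zero    = refl
  length-words cs (suc m) = trans (length-⊗ cs (words cs m)) (cong (length cs *_) (length-words cs m))

  exactly : A → List A → (m j : ℕ) → List (Vector A m)
  exactly s ds zero    zero    = [ [] ]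
  exactly s ds zero    (suc j) = List.[]
  exactly s ds (suc m) zero    = ds ⊗ exactly s ds m zero
  exactly s ds (suc m) (suc j) = map (s ∷_) (exactly s ds m j) ++ ds ⊗ exactly s ds m (suc j)

  ∈-exactly-∷ˢ : ∀ {s ds m j x} → x ∈ exactly s ds m j → s ∷ x ∈ exactly s ds (suc m) (suc j)
  ∈-exactly-∷ˢ {s} x∈ = ∈-++⁺ˡ (∈-map⁺ (s ∷_) x∈)

  ∈-exactly-∷ᵈ : ∀ {s ds m} j {d x} → d ∈ ds → x ∈ exactly s ds m j → d ∷ x ∈ exactly s ds (suc m) j
  ∈-exactly-∷ᵈ               zero    d∈ x∈ = ∈-⊗ d∈ x∈
  ∈-exactly-∷ᵈ {s} {m = m} (suc j) d∈ x∈ = ∈-++⁺ʳ (map (s ∷_) (exactly s _ m j)) (∈-⊗ d∈ x∈)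

  length-exactly : ∀ s ds m j → length (exactly s ds m j) ≡ (m C j) * length ds ^ (m ∸ j)
  length-exactly s ds zero    zero    = refl
  length-exactly s ds zero    (suc j) = refl
  length-exactly s ds (suc m) zero    = begin
    length (ds ⊗ exactly s ds m zero)       ≡⟨ length-⊗ ds (exactly s ds m zero) ⟩
    d * length (exactly s ds m zero)        ≡⟨ cong (d *_) (length-exactly s ds m zero) ⟩
    d * (1 * d ^ m)                         ≡⟨ cong (d *_) (*-identityˡ (d ^ m)) ⟩
    d ^ suc m                               ≡⟨ *-identityˡ (d ^ suc m) ⟨
    1 * d ^ suc m                           ∎
    where
    open ≡-Reasoning
    d = length ds
  length-exactly s ds (suc m) (suc j) = begin
    length (map (s ∷_) (exactly s ds m j) ++ ds ⊗ exactly s ds m (suc j))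
      ≡⟨ length-++ (map (s ∷_) (exactly s ds m j)) ⟩
    length (map (s ∷_) (exactly s ds m j)) + length (ds ⊗ exactly s ds m (suc j))
      ≡⟨ cong₂ _+_ (length-map (s ∷_) (exactly s ds m j)) (length-⊗ ds (exactly s ds m (suc j))) ⟩
    length (exactly s ds m j) + d * length (exactly s ds m (suc j))
      ≡⟨ cong₂ (λ a b → a + d * b) (length-exactly s ds m j) (length-exactly s ds m (suc j)) ⟩
    (m C j) * d ^ (m ∸ j) + d * ((m C suc j) * d ^ (m ∸ suc j))
      ≡⟨ cong ((m C j) * d ^ (m ∸ j) +_) *-C-^-shift ⟩
    (m C j) * d ^ (m ∸ j) + (m C suc j) * d ^ (m ∸ j)
      ≡⟨ *-distribʳ-+ (d ^ (m ∸ j)) (m C j) (m C suc j) ⟨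
    ((m C j) + (m C suc j)) * d ^ (m ∸ j)
      ≡⟨ cong (_* d ^ (m ∸ j)) (nCk+nC[k+1]≡[n+1]C[k+1] m j) ⟩
    (suc m C suc j) * d ^ (m ∸ j)
      ∎
    where
    open ≡-Reasoning
    d = length ds
    -- for j ≥ m both sides vanish, since then m C suc j ≡ 0
    *-C-^-shift : d * ((m C suc j) * d ^ (m ∸ suc j)) ≡ (m C suc j) * d ^ (m ∸ j)
    *-C-^-shift with j <? m
    ... | yes j<m = begin
      d * ((m C suc j) * d ^ (m ∸ suc j))  ≡⟨ x∙yz≈y∙xz d (m C suc j) _ ⟩
      (m C suc j) * d ^ suc (m ∸ suc j)    ≡⟨ cong (λ e → (m C suc j) * d ^ e) (+-∸-assoc 1 j<m) ⟨
      (m C suc j) * d ^ (m ∸ j)            ∎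
    ... | no j≮m rewrite k>n⇒nCk≡0 (s≤s (≮⇒≥ j≮m)) = *-zeroʳ d

module _ {A B : Set} {R : A → B → Set} where

  words-covers : ∀ {m cs} {y : Vector B m} →
                 (∀ k → Covered R cs (y k)) → Covered (Pointwise R) (words cs m) y
  words-covers {zero}  _ = [] , here refl , λ ()
  words-covers {suc m} h with h zero | words-covers (h ∘ suc)
  ... | c , c∈ , r | x , x∈ , rs = c ∷ x , ∈-⊗ c∈ x∈ , Pointwise-∷ R r rs

  module _ (s : A) (ds : List A) where

    private
      Covered-exactly : ∀ {m} → ℕ → Vector B m → Set
      Covered-exactly {m} j = Covered (Pointwise R) (exactly s ds m j)

    cover-∷ˢ : ∀ {m j} {y : Vector B (suc m)} →
               R s (head y) → Covered-exactly j (tail y) → Covered-exactly (suc j) y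
    cover-∷ˢ r (x , x∈ , rs) = s ∷ x , ∈-exactly-∷ˢ x∈ , Pointwise-∷ R r rs

    cover-∷ᵈ : ∀ {m} j {d} {y : Vector B (suc m)} →
               d ∈ ds → R d (head y) → Covered-exactly j (tail y) → Covered-exactly j y
    cover-∷ᵈ j d∈ r (x , x∈ , rs) = _ , ∈-exactly-∷ᵈ j d∈ x∈ , Pointwise-∷ R r rs

    exactly-covers : ∀ {m} {y : Vector B m} → (∀ k → R s (y k) ⊎ Covered R ds (y k)) →
                     ∃[ j ] j ≤ m × Covered-exactly j y
    exactly-covers {zero}  _ = 0 , z≤n , [] , here refl , λ ()
    exactly-covers {suc m} h with exactly-covers (h ∘ suc) | h zero
    ... | j , j≤m , c | inj₁ r            = suc j , s≤s j≤m , cover-∷ˢ r c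
    ... | j , j≤m , c | inj₂ (d , d∈ , r) = j , m≤n⇒m≤1+n j≤m , cover-∷ᵈ j d∈ r c

    -- At a position related both to s and to some d ∈ ds the count of s's can go either way.
    exactly-covers-adjacent : ∀ {m} {y : Vector B m} → (∀ k → R s (y k) ⊎ Covered R ds (y k)) →
                              ∃[ k ] R s (y k) × Covered R ds (y k) →
                              ∃[ j ] suc j ≤ m × Covered-exactly j y × Covered-exactly (suc j) y
    exactly-covers-adjacent {suc m} h (zero , r , d , d∈ , r′) with exactly-covers (h ∘ suc)
    ... | j , j≤m , c = j , s≤s j≤m , cover-∷ᵈ j d∈ r′ c , cover-∷ˢ r c
    exactly-covers-adjacent {suc m} h (suc k , flexible)
      with exactly-covers-adjacent (h ∘ suc) (k , flexible) | h zero
    ... | j , j<m , c , c′ | inj₁ r = suc j , s≤s j<m , cover-∷ˢ r c , cover-∷ˢ r c′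
    ... | j , j<m , c , c′ | inj₂ (d , d∈ , r) =
      j , m≤n⇒m≤1+n j<m , cover-∷ᵈ j d∈ r c , cover-∷ᵈ (suc j) d∈ r c′

∀-or-∃ : ∀ {m} {P Q : Fin m → Set} → (∀ k → P k ⊎ Q k) → (∀ k → P k) ⊎ ∃[ k ] Q k
∀-or-∃ {zero}  _ = inj₁ λ ()
∀-or-∃ {suc m} h with h zero | ∀-or-∃ (h ∘ suc)
... | inj₂ q | _            = inj₂ (zero , q)
... | inj₁ _ | inj₂ (k , q) = inj₂ (suc k , q)
... | inj₁ p | inj₁ ps      = inj₁ λ { zero → p ; (suc k) → ps k }

concatFrom1 : {A : Set} → ℕ → (ℕ → List A) → List A
concatFrom1 zero    F = List.[]
concatFrom1 (suc K) F = concatFrom1 K F ++ F (suc K)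

length-concatFrom1 : ∀ {A : Set} K (F : ℕ → List A) {g : ℕ → ℕ} →
                     (∀ i → length (F i) ≡ g i) → length (concatFrom1 K F) ≡ sumFrom1 K g
length-concatFrom1 zero    F eq = refl
length-concatFrom1 (suc K) F eq =
  trans (length-++ (concatFrom1 K F)) (cong₂ _+_ (length-concatFrom1 K F eq) (eq (suc K)))

∈-concatFrom1 : ∀ {A : Set} {K} {F : ℕ → List A} {x} i → suc i ≤ K → x ∈ F (suc i) → x ∈ concatFrom1 K F
∈-concatFrom1 {K = suc K} {F} i (s≤s i≤K) x∈ with m≤n⇒m<n∨m≡n i≤K
... | inj₁ i<K = ∈-++⁺ˡ (∈-concatFrom1 i i<K x∈)
... | inj₂ refl = ∈-++⁺ʳ (concatFrom1 K F) x∈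

odd-among-consecutive : ∀ {m} j → suc j ≤ m →
                        ∃[ t ] suc t ≤ ceilHalf m × (2 * suc t ∸ 1 ≡ j ⊎ 2 * suc t ∸ 1 ≡ suc j)
odd-among-consecutive {suc zero}    zero          _ = 0 , s≤s z≤n , inj₂ refl
odd-among-consecutive {suc zero}    (suc j)       (s≤s ())
odd-among-consecutive {suc (suc m)} zero          _ = 0 , s≤s z≤n , inj₂ refl
odd-among-consecutive {suc (suc m)} (suc zero)    _ = 0 , s≤s z≤n , inj₁ refl
odd-among-consecutive {suc (suc m)} (suc (suc j)) (s≤s (s≤s j<m))
  with odd-among-consecutive j j<m
... | t , t<m , eq = suc t , s≤s t<m , Data.Sum.map shift shift eq
  where
  shift : ∀ {a} → 2 * suc t ∸ 1 ≡ a → 2 * suc (suc t) ∸ 1 ≡ suc (suc a)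
  shift refl = cong suc (+-suc t (suc t + 0))

-- Block j of a word of length k·m consists of the coordinates j, m + j, …, (k − 1)·m + j.
blocks : ∀ {k m q} → Word (k * m) q → Vector (Word k q) m
blocks y j r = y (combine r j)

unblock : ∀ {k m q} → Vector (Word k q) m → Word (k * m) q
unblock {k} {m} x i = x (proj₂ (remQuot {k} m i)) (proj₁ (remQuot {k} m i))

unblock-skirts : ∀ {k m q} {x : Vector (Word k q) m} {y : Word (k * m) q} →
                 Pointwise Skirts x (blocks y) → Skirts (unblock x) y
unblock-skirts {k} {m} {y = y} sk i eq =
  sk (proj₂ (remQuot {k} m i)) (proj₁ (remQuot {k} m i))
     (trans eq (cong y (sym (combine-remQuot {k} m i))))

unblock-skirting : ∀ {k m q} (S : List (Vector (Word k q) m)) →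
                   (∀ y → Covered (Pointwise Skirts) S y) → IsSkirting (map unblock S)
unblock-skirting S covers y with covers (blocks y)
... | x , x∈ , sk = unblock x , ∈-map⁺ _ x∈ , unblock-skirts sk

⟨_,_⟩ : ∀ {q} → Fin q → Fin q → Word 2 q
⟨ a , b ⟩ = a ∷ b ∷ []

skirts-⟨,⟩ : ∀ {q} {a b : Fin q} {y : Word 2 q} → a ≢ y 0F → b ≢ y 1F → Skirts ⟨ a , b ⟩ y
skirts-⟨,⟩ a≢ b≢ 0F = a≢
skirts-⟨,⟩ a≢ b≢ 1F = b≢

skirts-η : ∀ {q} {x y : Word 2 q} → Skirts x ⟨ y 0F , y 1F ⟩ → Skirts x y
skirts-η sk 0F = sk 0F
skirts-η sk 1F = sk 1F

diagonal : List (Word 2 3)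
diagonal = ⟨ 0F , 0F ⟩ List.∷ ⟨ 1F , 1F ⟩ List.∷ List.[]

antidiagonal : List (Word 2 3)
antidiagonal = ⟨ 0F , 1F ⟩ List.∷ ⟨ 1F , 0F ⟩ List.∷ List.[]

twos : Word 2 3
twos = ⟨ 2F , 2F ⟩

skirted-by-twos-or-antidiagonal : ∀ a b → Skirts twos ⟨ a , b ⟩ ⊎ Covered Skirts antidiagonal ⟨ a , b ⟩
skirted-by-twos-or-antidiagonal 0F 0F = inj₁ (skirts-⟨,⟩ (λ ()) (λ ()))
skirted-by-twos-or-antidiagonal 0F 1F = inj₁ (skirts-⟨,⟩ (λ ()) (λ ()))
skirted-by-twos-or-antidiagonal 0F 2F = inj₂ (_ , there (here refl) , skirts-⟨,⟩ (λ ()) (λ ()))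
skirted-by-twos-or-antidiagonal 1F 0F = inj₁ (skirts-⟨,⟩ (λ ()) (λ ()))
skirted-by-twos-or-antidiagonal 1F 1F = inj₁ (skirts-⟨,⟩ (λ ()) (λ ()))
skirted-by-twos-or-antidiagonal 1F 2F = inj₂ (_ , here refl , skirts-⟨,⟩ (λ ()) (λ ()))
skirted-by-twos-or-antidiagonal 2F 0F = inj₂ (_ , here refl , skirts-⟨,⟩ (λ ()) (λ ()))
skirted-by-twos-or-antidiagonal 2F 1F = inj₂ (_ , there (here refl) , skirts-⟨,⟩ (λ ()) (λ ()))
skirted-by-twos-or-antidiagonal 2F 2F = inj₂ (_ , here refl , skirts-⟨,⟩ (λ ()) (λ ()))

skirted-by-diagonal-or-flexible : ∀ a b → Covered Skirts diagonal ⟨ a , b ⟩ ⊎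
                                  Skirts twos ⟨ a , b ⟩ × Covered Skirts antidiagonal ⟨ a , b ⟩
skirted-by-diagonal-or-flexible 0F 0F = inj₁ (_ , there (here refl) , skirts-⟨,⟩ (λ ()) (λ ()))
skirted-by-diagonal-or-flexible 0F 1F = inj₂ (skirts-⟨,⟩ (λ ()) (λ ()) , _ , there (here refl) , skirts-⟨,⟩ (λ ()) (λ ()))
skirted-by-diagonal-or-flexible 0F 2F = inj₁ (_ , there (here refl) , skirts-⟨,⟩ (λ ()) (λ ()))
skirted-by-diagonal-or-flexible 1F 0F = inj₂ (skirts-⟨,⟩ (λ ()) (λ ()) , _ , here refl , skirts-⟨,⟩ (λ ()) (λ ()))
skirted-by-diagonal-or-flexible 1F 1F = inj₁ (_ , here refl , skirts-⟨,⟩ (λ ()) (λ ()))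
skirted-by-diagonal-or-flexible 1F 2F = inj₁ (_ , here refl , skirts-⟨,⟩ (λ ()) (λ ()))
skirted-by-diagonal-or-flexible 2F 0F = inj₁ (_ , there (here refl) , skirts-⟨,⟩ (λ ()) (λ ()))
skirted-by-diagonal-or-flexible 2F 1F = inj₁ (_ , here refl , skirts-⟨,⟩ (λ ()) (λ ()))
skirted-by-diagonal-or-flexible 2F 2F = inj₁ (_ , here refl , skirts-⟨,⟩ (λ ()) (λ ()))

skirtingBlocks : (m : ℕ) → List (Vector (Word 2 3) m)
skirtingBlocks m =
  words diagonal m ++ concatFrom1 (ceilHalf m) (λ i → exactly twos antidiagonal m (2 * i ∸ 1))

length-skirtingBlocks : ∀ m → length (skirtingBlocks m) ≡ bound m
length-skirtingBlocks m = trans (length-++ (words diagonal m))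
  (cong₂ _+_ (length-words diagonal m)
             (length-concatFrom1 (ceilHalf m) _ (λ i → length-exactly twos antidiagonal m (2 * i ∸ 1))))

covered-by-odd-part : ∀ {m j} {y : Vector (Word 2 3) m} t → suc t ≤ ceilHalf m → 2 * suc t ∸ 1 ≡ j →
                      Covered (Pointwise Skirts) (exactly twos antidiagonal m j) y →
                      Covered (Pointwise Skirts) (skirtingBlocks m) y
covered-by-odd-part {m} t t< refl (x , x∈ , sk) =
  x , ∈-++⁺ʳ (words diagonal m) (∈-concatFrom1 t t< x∈) , sk

skirtingBlocks-covers-⟨,⟩ : ∀ m (a b : Fin m → Fin 3) →
                            Covered (Pointwise Skirts) (skirtingBlocks m) (λ k → ⟨ a k , b k ⟩)
skirtingBlocks-covers-⟨,⟩ m a b with ∀-or-∃ (λ k → skirted-by-diagonal-or-flexible (a k) (b k))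
... | inj₁ diag with words-covers {R = Skirts} diag
...   | x , x∈ , sk = x , ∈-++⁺ˡ x∈ , sk
skirtingBlocks-covers-⟨,⟩ m a b | inj₂ flexible
  with exactly-covers-adjacent {R = Skirts} twos antidiagonal
         (λ k → skirted-by-twos-or-antidiagonal (a k) (b k)) flexible
... | j , j<m , c , c′ with odd-among-consecutive j j<m
...   | t , t< , inj₁ eq = covered-by-odd-part t t< eq c
...   | t , t< , inj₂ eq = covered-by-odd-part t t< eq c′

skirtingBlocks-covers : ∀ m (y : Vector (Word 2 3) m) → Covered (Pointwise Skirts) (skirtingBlocks m) y
skirtingBlocks-covers m y with skirtingBlocks-covers-⟨,⟩ m (λ k → y k 0F) (λ k → y k 1F)
... | x , x∈ , sk = x , x∈ , λ k → skirts-η (sk k)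

proposition3p2 : ∀ (n : ℕ) → 2 ≤ n → ∀ (m : ℕ) → n ≡ 2 * m → fLe n 3 (bound m)
proposition3p2 .(2 * m) _ m refl =
  map unblock (skirtingBlocks m) ,
  unblock-skirting (skirtingBlocks m) (skirtingBlocks-covers m) ,
  ≤-reflexive (trans (length-map unblock (skirtingBlocks m)) (length-skirtingBlocks m))
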